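{- Let $n\ge1$ and $1\le k\le n$. Then the clause $\neg P\alpha_{n-k+1}\lor Pf^{2^{n-k+1}}\alpha_{n-k+1}$ is derivable by forgetful resolution from (the conjunctive normal form of) $\bigwedge_{s\in T_{n-k}}(Ps\supset Pfs)$.
   Context: $P$ is a unary predicate symbol, $f$ a unary function symbol, $a$ a constant, $\alpha_1,\ldots,\alpha_n$ variables (treated as constants), and $\alpha_{n+1}=a$. For $0\le k\le n$ let $T_k=\{\alpha_{k+1},f\alpha_{k+1},\ldots,f^{2^{k+1}-1}\alpha_{k+1}\}$. The CNF of $\bigwedge_{s\in T}(Ps\supset Pfs)$ is the clause set $\{\{\neg Ps,Pfs\}\mid s\in T\}$. For clauses $C_1,C_2$, if there is exactly one literal $L\in C_1$ whose dual $\overline L$ is in $C_2$, their resolvent is $\mathrm{res}(C_1,C_2)=(C_1\setminus\{L\})\cup(C_2\setminus\{\overline L\})$, otherwise undefined. For a clause set $A$, the forgetful resolution operator gives $\mathcal R(A)=\{\{\mathrm{res}(C_i,C_j)\}\cup(A\setminus\{C_i,C_j\})\mid C_i\ne C_j\in A,\ \mathrm{res}(C_i,C_j)\text{ defined}\}$. A clause is derivable by forgetful resolution from $A$ if it belongs to some clause set $A_r$ with $A=A_0,A_1,\ldots,A_r$ and $A_{i+1}\in\mathcal R(A_i)$. -}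

module Defs where

open import Data.Nat using (ℕ; zero; suc; _^_; _<_; _∸_; s≤s)
open import Data.Nat.Properties using (m∸n≤m)
open import Data.Fin using (Fin; toℕ; fromℕ<)
open import Data.List using (List; []; _∷_; map; upTo)
open import Data.List.Membership.Propositional using (_∈_)
open import Data.Product using (Σ; ∃; _×_; _,_)
open import Data.Sum using (_⊎_)
open import Relation.Nullary using (¬_)
open import Relation.Binary.PropositionalEquality using (_≡_; _≢_)
open import Relation.Binary.Construct.Closure.ReflexiveTransitive using (Star)
open import Function.Bundles using (_⇔_)

-- Terms over the constants α₁,…,αₙ, α_{n+1} = a, and the unary function f.
-- (con i) is α_{toℕ i + 1}; the last index (i = n) is the constant a.
data Term (n : ℕ) : Set where
  con : Fin (suc n) → Term n
  f   : Term n → Term n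

f^ : ∀ {n} → ℕ → Term n → Term n
f^ zero    t = t
f^ (suc j) t = f (f^ j t)

data Lit (n : ℕ) : Set where
  pos : Term n → Lit n
  neg : Term n → Lit n

dual : ∀ {n} → Lit n → Lit n
dual (pos t) = neg t
dual (neg t) = pos t

-- A clause is a finite set of literals, represented by a list
-- (order and multiplicity irrelevant: equality is extensional, _≐_).
Clause : ℕ → Set
Clause n = List (Lit n)

_≐_ : ∀ {n} → Clause n → Clause n → Set
C ≐ D = ∀ L → (L ∈ C) ⇔ (L ∈ D)

ClauseSet : ℕ → Set
ClauseSet n = List (Clause n)

_∈ₛ_ : ∀ {n} → Clause n → ClauseSet n → Set
C ∈ₛ A = Σ _ λ D → D ∈ A × C ≐ D

-- Res C₁ C₂ R : res(C₁,C₂) is defined and equals R, i.e. there is exactly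
-- one literal L ∈ C₁ with dual L ∈ C₂, and R = (C₁ ∖ {L}) ∪ (C₂ ∖ {dual L}).
Res : ∀ {n} → Clause n → Clause n → Clause n → Set
Res C₁ C₂ R =
  Σ _ λ L → L ∈ C₁ × dual L ∈ C₂
    × (∀ L′ → L′ ∈ C₁ → dual L′ ∈ C₂ → L′ ≡ L)
    × (∀ M → (M ∈ R) ⇔ ((M ∈ C₁ × M ≢ L) ⊎ (M ∈ C₂ × M ≢ dual L)))

-- One forgetful resolution step: B ∈ 𝓡(A), i.e. B = {res(Cᵢ,Cⱼ)} ∪ (A ∖ {Cᵢ,Cⱼ})
-- for some Cᵢ ≠ Cⱼ in A with res(Cᵢ,Cⱼ) defined (equality of sets of clauses).
Step : ∀ {n} → ClauseSet n → ClauseSet n → Set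
Step {n} A B =
  Σ (Clause n) λ Ci → Σ (Clause n) λ Cj → Σ (Clause n) λ R →
    Ci ∈ₛ A × Cj ∈ₛ A × ¬ (Ci ≐ Cj) × Res Ci Cj R
    × (∀ D → (D ∈ₛ B) ⇔ (D ≐ R ⊎ (D ∈ₛ A × ¬ (D ≐ Ci) × ¬ (D ≐ Cj))))

Derivable : ∀ {n} → Clause n → ClauseSet n → Set
Derivable {n} C A = Σ (ClauseSet n) λ B → Star Step A B × C ∈ₛ B

-- α_{k+1} for k : Fin (suc n)  (α_{n+1} = a)
α : ∀ {n} → Fin (suc n) → Term n
α k = con k

T : ∀ {n} → Fin (suc n) → List (Term n)
T k = map (λ j → f^ j (α k)) (upTo (2 ^ suc (toℕ k)))

CNF : ∀ {n} → List (Term n) → ClauseSet n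
CNF T′ = map (λ s → neg s ∷ pos (f s) ∷ []) T′

idx : (n k : ℕ) → Fin (suc n)
idx n k = fromℕ< (s≤s (m∸n≤m n k))

module Submission where

-- The clause set CNF(T_k) is a chain of implications
--   link a = {¬P f^a t, P f^(a+1) t}      for a = 0, …, N-1,
-- with t = α_{k+1} and N = 2^(k+1).  Writing span j = {¬P t, P f^j t},
-- the first link is span 1, and resolving span j with link j yields
-- span (j+1) (on the single clashing literal P f^j t).  Forgetful
-- resolution then replaces the pair by the resolvent, so the clause sets
--   span j ∷ links j r   (links j r = link j, …, link (j+r-1))
-- form a resolution sequence ending in the single clause span (j+r).
-- Ingredients: f^ is injective (via term depth), which makes the clauses
-- involved pairwise distinct and the clashing literal unique; then one
-- resolution step (span-link-step) and its iteration (resolve-chain).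

open import Defs
open import Data.Nat using (ℕ; zero; suc; _+_; _≤_; _<_; _∸_; _^_; z≤n; s≤s)
open import Data.Nat.Properties
  using (+-cancelʳ-≡; +-suc; +-identityʳ; m^n>0; m∸n≤m; ≤-trans; n≤1+n; ≤-refl; <⇒≢)
open import Data.Fin using (toℕ)
open import Data.Fin.Properties using (toℕ-fromℕ<)
open import Data.List using ([]; _∷_; map; applyUpTo; upTo)
open import Data.List.Relation.Unary.Any using (here; there)
open import Data.List.Membership.Propositional using (_∈_)
open import Data.Product using (Σ; _×_; _,_)
open import Data.Sum using (_⊎_; inj₁; inj₂)
open import Data.Empty using (⊥-elim)
open import Relation.Nullary using (¬_)
open import Relation.Binary.PropositionalEquality
  using (_≡_; _≢_; refl; sym; trans; cong; subst)
open import Relation.Binary.Construct.Closure.ReflexiveTransitive using (Star; ε; _◅_)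
open import Function.Bundles using (_⇔_; mk⇔; Equivalence)
import Function.Properties.Equivalence as ⇔

module _ {n : ℕ} where

  ≐-refl : {C : Clause n} → C ≐ C
  ≐-refl L = ⇔.refl

  ≐-sym : {C D : Clause n} → C ≐ D → D ≐ C
  ≐-sym p L = ⇔.sym (p L)

  ≐-trans : {C D E : Clause n} → C ≐ D → D ≐ E → C ≐ E
  ≐-trans p q L = ⇔.trans (p L) (q L)

  atom : Lit n → Term n
  atom (pos u) = u
  atom (neg u) = u

  depth : Term n → ℕ
  depth (con _) = 0
  depth (f u)   = suc (depth u)

  depth-f^ : ∀ a (t : Term n) → depth (f^ a t) ≡ a + depth t
  depth-f^ zero    t = refl
  depth-f^ (suc a) t = cong suc (depth-f^ a t)

  f^-injective : ∀ (t : Term n) a b → f^ a t ≡ f^ b t → a ≡ b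
  f^-injective t a b p = +-cancelʳ-≡ (depth t) a b
    (trans (sym (depth-f^ a t)) (trans (cong depth p) (depth-f^ b t)))

module Chain {n : ℕ} (t : Term n) where

  link : ℕ → Clause n
  link a = neg (f^ a t) ∷ pos (f^ (suc a) t) ∷ []

  span : ℕ → Clause n
  span j = neg t ∷ pos (f^ j t) ∷ []

  links : ℕ → ℕ → ClauseSet n
  links j zero    = []
  links j (suc r) = link j ∷ links (suc j) r

  CNF≡links : ∀ (g : ℕ → ℕ) j r → (∀ x → g x ≡ j + x) →
    CNF (map (λ i → f^ i t) (applyUpTo g r)) ≡ links j r
  CNF≡links g j zero    g≗j+ = refl
  CNF≡links g j (suc r) g≗j+ rewrite g≗j+ 0 | +-identityʳ j =
    cong (link j ∷_) (CNF≡links (λ x → g (suc x)) (suc j) r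
      (λ x → trans (g≗j+ (suc x)) (+-suc j x)))

  ∈links : ∀ {D} j r → D ∈ links j r → Σ ℕ λ a → j ≤ a × D ≡ link a
  ∈links j (suc r) (here refl) = j , ≤-refl , refl
  ∈links j (suc r) (there D∈) with ∈links (suc j) r D∈
  ... | a , j<a , refl = a , ≤-trans (n≤1+n j) j<a , refl

  -- Distinctness of the clauses: two clauses are different if the first
  -- literal of one has a term not occurring in the other.
  link≢span : ∀ a j → 1 ≤ a → ¬ (link a ≐ span j)
  link≢span (suc a) j _ eq with Equivalence.to (eq (neg (f^ (suc a) t))) (here refl)
  ... | here p with f^-injective t (suc a) 0 (cong atom p)
  ... | ()
  link≢span (suc a) j _ eq | there (here ())
  link≢span (suc a) j _ eq | there (there ())

  link≢link : ∀ a j → j < a → ¬ (link a ≐ link j)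
  link≢link a j j<a eq with Equivalence.to (eq (neg (f^ a t))) (here refl)
  ... | here p = <⇒≢ j<a (sym (f^-injective t a j (cong atom p)))
  ... | there (here ())
  ... | there (there ())

  span≢link : ∀ j → ¬ (span j ≐ link j)
  span≢link j eq with Equivalence.from (eq (pos (f^ (suc j) t))) (there (here refl))
  ... | here ()
  ... | there (here p) with f^-injective t (suc j) j (cong atom p)
  ... | ()
  span≢link j eq | there (there ())

  -- res(span j, link j) = span (j+1): P f^j t is the only clashing literal.
  resolve-span-link : ∀ j → Res (span j) (link j) (span (suc j))
  resolve-span-link j = pos (f^ j t) , there (here refl) , here refl , unique , resolvent
    where
    unique : ∀ L → L ∈ span j → dual L ∈ link j → L ≡ pos (f^ j t)
    unique _ (here refl) (here ())
    unique _ (here refl) (there (here p)) with f^-injective t 0 (suc j) (cong atom p)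
    ... | ()
    unique _ (here refl) (there (there ()))
    unique _ (there (here refl)) _ = refl

    Remaining : Lit n → Set
    Remaining M = (M ∈ span j × M ≢ pos (f^ j t)) ⊎ (M ∈ link j × M ≢ neg (f^ j t))

    to : ∀ M → M ∈ span (suc j) → Remaining M
    to _ (here refl)         = inj₁ (here refl , λ ())
    to _ (there (here refl)) = inj₂ (there (here refl) , λ ())

    from : ∀ M → Remaining M → M ∈ span (suc j)
    from _ (inj₁ (here refl , _))          = here refl
    from _ (inj₁ (there (here refl) , ≢L)) = ⊥-elim (≢L refl)
    from _ (inj₂ (here refl , ≢L))         = ⊥-elim (≢L refl)
    from _ (inj₂ (there (here refl) , _))  = there (here refl)

    resolvent : ∀ M → (M ∈ span (suc j)) ⇔ Remaining M
    resolvent M = mk⇔ (to M) (from M)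

  span-link-step : ∀ j r → Step (span j ∷ links j (suc r)) (span (suc j) ∷ links (suc j) r)
  span-link-step j r =
    span j , link j , span (suc j)
    , (span j , here refl , ≐-refl) , (link j , there (here refl) , ≐-refl)
    , span≢link j , resolve-span-link j , λ D → mk⇔ (to D) (from D)
    where
    Before = span j ∷ links j (suc r)

    Kept : Clause n → Set
    Kept D = D ≐ span (suc j) ⊎ (D ∈ₛ Before × ¬ (D ≐ span j) × ¬ (D ≐ link j))

    to : ∀ D → D ∈ₛ (span (suc j) ∷ links (suc j) r) → Kept D
    to D (_ , here refl , D≐) = inj₁ D≐
    to D (_ , there E∈ , D≐) with ∈links (suc j) r E∈
    ... | a , j<a , refl =
      inj₂ ( (link a , there (there E∈) , D≐)
           , (λ D≐span → link≢span a j (≤-trans (s≤s z≤n) j<a) (≐-trans (≐-sym D≐) D≐span))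
           , (λ D≐link → link≢link a j j<a (≐-trans (≐-sym D≐) D≐link)))

    from : ∀ D → Kept D → D ∈ₛ (span (suc j) ∷ links (suc j) r)
    from D (inj₁ D≐) = span (suc j) , here refl , D≐
    from D (inj₂ ((_ , here refl , D≐) , ≢span , _))          = ⊥-elim (≢span D≐)
    from D (inj₂ ((_ , there (here refl) , D≐) , _ , ≢link))  = ⊥-elim (≢link D≐)
    from D (inj₂ ((E , there (there E∈) , D≐) , _ , _))       = E , there E∈ , D≐

  resolve-chain : ∀ j r → Star Step (span j ∷ links j r) (span (j + r) ∷ [])
  resolve-chain j zero    rewrite +-identityʳ j = ε
  resolve-chain j (suc r) rewrite +-suc j r =
    span-link-step j r ◅ resolve-chain (suc j) r

  -- Main result for an arbitrary term: {¬P t, P f^N t} is derivable from the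
  -- CNF of {t, …, f^(N-1) t}; note link 0 is span 1, so the chain starts there.
  chain-derivable : ∀ N → 1 ≤ N → Derivable (span N) (CNF (map (λ i → f^ i t) (upTo N)))
  chain-derivable (suc r) _ rewrite CNF≡links (λ x → x) 0 (suc r) (λ x → refl) =
    span (suc r) ∷ [] , resolve-chain 1 r , span (suc r) , here refl , ≐-refl

open Chain using (span; chain-derivable)

lemma12 : (n k : ℕ) → 1 ≤ n → 1 ≤ k → k ≤ n →
    Derivable (neg (α (idx n k)) ∷ pos (f^ (2 ^ suc (n ∸ k)) (α (idx n k))) ∷ [])
    (CNF (T (idx n k)))
lemma12 n k _ _ _ =
  subst (λ m → Derivable (span t (2 ^ suc m)) (CNF (T (idx n k))))
        (toℕ-fromℕ< (s≤s (m∸n≤m n k)))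
        (chain-derivable t (2 ^ suc m′) (m^n>0 2 (suc m′)))
  where
  t = α (idx n k)
  m′ = toℕ (idx n k)
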